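{- Let $G=(V^l\cup V^r\cup\{s,t\},E)$ be an outerplanar $st$-digraph and let $E_c$ be an acyclic HP-completion set of $G$. Then the hamiltonian path of $(V,E\cup E_c)$ induced by $E_c$ visits the vertices of $V^l$ (resp. $V^r$) in the order in which they appear on the left side (resp. right side) of $G$.
   Context: An $st$-digraph is a finite acyclic digraph with exactly one source $s$ and one sink $t$. An outerplanar $st$-digraph is an $st$-digraph with a fixed upward planar embedding in which all vertices lie on the external face; its external boundary consists of two directed paths from $s$ to $t$, the left side and the right side, whose vertices other than $s,t$ form $V^l$ and $V^r$ respectively. An acyclic HP-completion set of $G=(V,E)$ is a set $E_c$ of new directed edges such that $(V,E\cup E_c)$ is acyclic and has a hamiltonian path from $s$ to $t$ that uses all edges of $E_c$ (the induced hamiltonian path). -}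

module Defs where

open import Data.Nat using (ℕ; zero; suc; _+_; _∸_; _<_; _⊓_; _⊔_)
open import Data.Fin using (Fin; toℕ)
open import Data.List using (allFin)
open import Data.List using (List; []; _∷_; _++_; map; [_])
open import Data.List.Membership.Propositional using (_∈_)
open import Data.List.Relation.Unary.Unique.Propositional using (Unique)
open import Data.Product using (Σ; _×_; ∃₂)
open import Data.Sum using (_⊎_)
open import Data.Empty using (⊥)
open import Relation.Nullary using (¬_)
open import Relation.Binary.PropositionalEquality using (_≡_; _≢_)
open import Relation.Binary.Construct.Closure.Transitive using (TransClosure)

-- Vertices of an outerplanar st-digraph whose left side has p inner
-- vertices L 0, …, L (p-1) (in order from s to t) and whose right side
-- has q inner vertices R 0, …, R (q-1) (in order from s to t).

data Vtx (p q : ℕ) : Set where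
  s t : Vtx p q
  L   : Fin p → Vtx p q
  R   : Fin q → Vtx p q

Digraph : Set → Set₁
Digraph V = V → V → Set

_∪ᴱ_ : {V : Set} → Digraph V → Digraph V → Digraph V
(E ∪ᴱ F) a b = E a b ⊎ F a b

Acyclic : {V : Set} → Digraph V → Set
Acyclic E = ∀ v → ¬ TransClosure E v v

data PathIn {V : Set} (E : Digraph V) : List V → Set where
  nil  : PathIn E []
  one  : ∀ a → PathIn E (a ∷ [])
  cons : ∀ {a b xs} → E a b → PathIn E (b ∷ xs) → PathIn E (a ∷ b ∷ xs)

leftSide : (p q : ℕ) → List (Vtx p q)
leftSide p q = s ∷ map L (allFin p) ++ t ∷ []

rightSide : (p q : ℕ) → List (Vtx p q)
rightSide p q = s ∷ map R (allFin q) ++ t ∷ []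

-- position on the external boundary, walking clockwise:
-- s, L 0, …, L (p-1), t, R (q-1), …, R 0
pos : {p q : ℕ} → Vtx p q → ℕ
pos s = 0
pos {p} (L i) = suc (toℕ i)
pos {p} t = suc p
pos {p} {q} (R j) = suc (p + q) ∸ toℕ j

Crossing : {p q : ℕ} → Vtx p q → Vtx p q → Vtx p q → Vtx p q → Set
Crossing a b c d =
  let x₁ = pos a ⊓ pos b ; y₁ = pos a ⊔ pos b
      x₂ = pos c ⊓ pos d ; y₂ = pos c ⊔ pos d
  in (x₁ < x₂ × x₂ < y₁ × y₁ < y₂) ⊎ (x₂ < x₁ × x₁ < y₂ × y₂ < y₁)

record IsSTDigraph {V : Set} (E : Digraph V) (src snk : V) : Set where
  field
    acyclic  : Acyclic E
    src-source : ∀ v → ¬ E v src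
    snk-sink   : ∀ v → ¬ E snk v
    unique-source : ∀ v → v ≢ src → Σ V λ u → E u v
    unique-sink   : ∀ v → v ≢ snk → Σ V λ w → E v w

-- Outerplanar st-digraph (with a fixed upward planar embedding having all
-- vertices on the external face): the external boundary consists of the
-- directed left side s → L 0 → … → L (p-1) → t and the directed right side
-- s → R 0 → … → R (q-1) → t; every edge is drawn inside the external face,
-- i.e. as a chord of the boundary cycle, and no two edges cross.
record IsOuterplanarST {p q : ℕ} (E : Digraph (Vtx p q)) : Set where
  field
    st          : IsSTDigraph E s t
    left-side   : PathIn E (leftSide p q)
    right-side  : PathIn E (rightSide p q)
    noncrossing : ∀ a b c d → E a b → E c d → ¬ Crossing a b c d

Consecutive : {V : Set} → V → V → List V → Set
Consecutive a b P = ∃₂ λ xs ys → P ≡ xs ++ a ∷ b ∷ ys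

Before : {V : Set} → V → V → List V → Set
Before a b P = ∃₂ λ xs ys → P ≡ xs ++ a ∷ ys × b ∈ ys

record IsHamPath {V : Set} (E : Digraph V) (src snk : V) (P : List V) : Set where
  field
    path   : PathIn E P
    unique : Unique P
    covers : ∀ v → v ∈ P
    start  : Σ (List V) λ rest → P ≡ src ∷ rest
    end    : Σ (List V) λ init → P ≡ init ++ snk ∷ []

-- Ec is an acyclic HP-completion set of G = (V, E) and P is the hamiltonian
-- path of (V, E ∪ Ec) induced by Ec: Ec consists of new edges, E ∪ Ec is
-- acyclic, and P is a hamiltonian s–t path of E ∪ Ec using every edge of Ec.
record IsAcyclicHPCompletion {p q : ℕ} (E Ec : Digraph (Vtx p q)) (P : List (Vtx p q)) : Set where
  field
    new       : ∀ a b → Ec a b → ¬ E a b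
    acyclic   : Acyclic (E ∪ᴱ Ec)
    hampath   : IsHamPath (E ∪ᴱ Ec) s t P
    uses-all  : ∀ a b → Ec a b → Consecutive a b P

-- A hamiltonian path of an acyclic digraph is a topological order: if a reaches b
-- and b came first, the path segment from b to a would close a cycle.  Both sides
-- of G are directed paths of G ⊆ G ∪ Ec, so each side vertex reaches the later
-- ones, and the induced hamiltonian path must list them in side order.
module Submission where

open import Defs
open import Data.Nat using (ℕ; s≤s)
open import Data.Fin using (Fin; _<_; zero; suc)
open import Data.List using (List; []; _∷_; _++_; map; tabulate; allFin)
open import Data.List.Properties using (++-assoc; map-++)
open import Data.List.Membership.Propositional using (_∈_)
open import Data.List.Membership.Propositional.Properties using (∈-++⁺ˡ; ∈-map⁺; ∈-tabulate⁺)
open import Data.List.Relation.Unary.Any using (here; there)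
open import Data.Product using (_×_; _,_)
open import Data.Sum using (_⊎_; inj₁; inj₂)
open import Data.Empty using (⊥-elim)
open import Function using (id)
open import Relation.Binary.PropositionalEquality using (_≡_; refl)
open import Relation.Binary.Construct.Closure.Transitive using (TransClosure; [_]; _∷_) renaming (_++_ to _⁺++_)

module _ {V : Set} where

  Before-∷ : ∀ {a b} x {P : List V} → Before a b P → Before a b (x ∷ P)
  Before-∷ x (xs , ys , refl , b∈ys) = x ∷ xs , ys , refl , b∈ys

  Before-++ʳ : ∀ {a b} {P : List V} Q → Before a b P → Before a b (P ++ Q)
  Before-++ʳ {a} Q (xs , ys , refl , b∈ys) =
    xs , ys ++ Q , ++-assoc xs (a ∷ ys) Q , ∈-++⁺ˡ b∈ys

  Before-map : ∀ {W : Set} (f : V → W) {a b} {P : List V} →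
               Before a b P → Before (f a) (f b) (map f P)
  Before-map f {a} (xs , ys , refl , b∈ys) =
    map f xs , map f ys , map-++ f xs (a ∷ ys) , ∈-map⁺ f b∈ys

  Before-total : ∀ {a b} (P : List V) → a ∈ P → b ∈ P →
                 a ≡ b ⊎ Before a b P ⊎ Before b a P
  Before-total (x ∷ P) (here refl) (here refl) = inj₁ refl
  Before-total (x ∷ P) (here refl) (there b∈P) = inj₂ (inj₁ ([] , P , refl , b∈P))
  Before-total (x ∷ P) (there a∈P) (here refl) = inj₂ (inj₂ ([] , P , refl , a∈P))
  Before-total (x ∷ P) (there a∈P) (there b∈P) with Before-total P a∈P b∈P
  ... | inj₁ a≡b        = inj₁ a≡b
  ... | inj₂ (inj₁ a≺b) = inj₂ (inj₁ (Before-∷ x a≺b))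
  ... | inj₂ (inj₂ b≺a) = inj₂ (inj₂ (Before-∷ x b≺a))

Before-tabulate : ∀ {A : Set} {n} (f : Fin n → A) {i j : Fin n} →
                  i < j → Before (f i) (f j) (tabulate f)
Before-tabulate f {zero}  {suc j} _ = [] , _ , refl , ∈-tabulate⁺ j
Before-tabulate f {suc i} {suc j} (s≤s i<j) = Before-∷ (f zero) (Before-tabulate (λ k → f (suc k)) i<j)

module _ {V : Set} {E : Digraph V} where

  TransClosure-mapʳ : ∀ {F : Digraph V} {a b} → TransClosure E a b → TransClosure (E ∪ᴱ F) a b
  TransClosure-mapʳ [ e ]    = [ inj₁ e ]
  TransClosure-mapʳ (e ∷ es) = inj₁ e ∷ TransClosure-mapʳ es

  PathIn-++⁻ʳ : ∀ xs {ys : List V} → PathIn E (xs ++ ys) → PathIn E ys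
  PathIn-++⁻ʳ []                     path          = path
  PathIn-++⁻ʳ (x ∷ [])     {[]}      _             = nil
  PathIn-++⁻ʳ (x ∷ [])     {y ∷ ys}  (cons _ path) = path
  PathIn-++⁻ʳ (x ∷ x′ ∷ xs)          (cons _ path) = PathIn-++⁻ʳ (x′ ∷ xs) path

  PathIn-reaches : ∀ {a b} {ys : List V} → PathIn E (a ∷ ys) → b ∈ ys → TransClosure E a b
  PathIn-reaches (cons e _)    (here refl) = [ e ]
  PathIn-reaches (cons e path) (there b∈ys) = e ∷ PathIn-reaches path b∈ys

  PathIn-Before⇒reaches : ∀ {a b} {P : List V} → PathIn E P → Before a b P → TransClosure E a b
  PathIn-Before⇒reaches path (xs , ys , refl , b∈ys) = PathIn-reaches (PathIn-++⁻ʳ xs path) b∈ys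

  reaches⇒Before : ∀ {src snk a b} {P : List V} → Acyclic E → IsHamPath E src snk P →
                   TransClosure E a b → Before a b P
  reaches⇒Before {a = a} {b} {P} acyclic ham a⇝b
    with Before-total P (IsHamPath.covers ham a) (IsHamPath.covers ham b)
  ... | inj₁ refl       = ⊥-elim (acyclic a a⇝b)
  ... | inj₂ (inj₁ a≺b) = a≺b
  ... | inj₂ (inj₂ b≺a) = ⊥-elim (acyclic a (a⇝b ⁺++ PathIn-Before⇒reaches (IsHamPath.path ham) b≺a))

Before-side : ∀ {V : Set} {n} (C : Fin n → V) (end₁ end₂ : V) {i j : Fin n} →
              i < j → Before (C i) (C j) (end₁ ∷ map C (allFin n) ++ end₂ ∷ [])
Before-side C end₁ end₂ i<j =
  Before-∷ end₁ (Before-++ʳ (end₂ ∷ []) (Before-map C (Before-tabulate id i<j)))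

lemma3 : (p q : ℕ) (E Ec : Digraph (Vtx p q)) (P : List (Vtx p q))
    → IsOuterplanarST E
    → IsAcyclicHPCompletion E Ec P
    → (∀ (i j : Fin p) → i < j → Before (L i) (L j) P)
      × (∀ (i j : Fin q) → i < j → Before (R i) (R j) P)
lemma3 p q E Ec P outerplanar completion =
  (λ i j i<j → side-order left-side (Before-side L s t i<j)) ,
  (λ i j i<j → side-order right-side (Before-side R s t i<j))
  where
  open IsOuterplanarST outerplanar
  open IsAcyclicHPCompletion completion

  side-order : ∀ {S a b} → PathIn E S → Before a b S → Before a b P
  side-order side a≺b = reaches⇒Before acyclic hampath (TransClosure-mapʳ (PathIn-Before⇒reaches side a≺b))
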